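{- Let $(W,S)$ be a finite Coxeter system and $I\subseteq S$. Then there is a percolating sequence of subsets of $W/W_I$ starting from $\{W_I\}$; that is, there is a finite folding sequence $J_0,J_1,\dots,J_N$ of subsets of $W/W_I$ with $J_0=\{W_I\}$ and $J_N=W/W_I$.
   Context: A finite Coxeter system $(W,S)$: $W$ is a finite group with generating set $S=\{s_1,\dots,s_m\}$ and presentation $\langle s_1,\dots,s_m \mid (s_is_j)^{m_{ij}}=1\rangle$, $m_{ii}=1$, $m_{ij}=m_{ji}\ge2$ for $i\ne j$. $\ell(w)$ is the length of $w$ (minimum number of generators from $S$ in a product equal to $w$). $T=\{usu^{ -1}:s\in S,u\in W\}$ is the set of reflections. For $I\subseteq S$, $W_I=\langle I\rangle$, and $w^I$ is the unique minimum-length element of the coset $wW_I$. For $t\in T$ define $L^I_t=\{wW_I:\ell((tw)^I)>\ell(w^I)\}$, $R^I_t=\{wW_I:\ell((tw)^I)<\ell(w^I)\}$, $F^I_t=\{wW_I:\ell((tw)^I)=\ell(w^I)\}$. The left-folding map $t^+$ on $W/W_I$ sends $wW_I$ to $twW_I$ if $wW_I\in R^I_t$ and fixes it otherwise; the right-folding map $t^-$ sends $wW_I$ to $twW_I$ if $wW_I\in L^I_t$ and fixes it otherwise. For $J\subseteq W/W_I$, $J^+(t)=\{wW_I: t^+(wW_I)\in J\}$ and $J^-(t)=\{wW_I:t^-(wW_I)\in J\}$. A folding sequence is a sequence $J_0,J_1,\dots$ of subsets of $W/W_I$ such that for each $i$ there is $t_i\in T$ with $J_{i+1}=J_i^+(t_i)$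 or $J_{i+1}=J_i^-(t_i)$. A percolating sequence is a finite folding sequence starting from a one-element set and ending with $W/W_I$. -}

module Defs where

open import Data.Nat using (ℕ; zero; suc; _<_; _≤_)
open import Data.Fin using (Fin)
open import Data.Fin.Subset using (Subset; _∈_)
open import Data.List using (List; []; _∷_; _++_; length; reverse; [_])
open import Data.List.Relation.Unary.All using (All)
open import Data.Product using (Σ; ∃; _×_; _,_)
open import Data.Sum using (_⊎_)
open import Relation.Binary.PropositionalEquality using (_≡_; _≢_)
open import Relation.Nullary using (¬_)
open import Data.List.Membership.Propositional using () renaming (_∈_ to _∈ₗ_)

record CoxeterMatrix (k : ℕ) : Set where
  field
    m      : Fin k → Fin k → ℕ
    m-diag : ∀ i → m i i ≡ 1
    m-sym  : ∀ i j → m i j ≡ m j i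
    m-off  : ∀ i j → i ≢ j → 2 ≤ m i j
open CoxeterMatrix public

Word : ℕ → Set
Word k = List (Fin k)

rel-word : ∀ {k} → ℕ → Fin k → Fin k → Word k
rel-word zero    i j = []
rel-word (suc n) i j = i ∷ j ∷ rel-word n i j

-- The congruence on words generated by the Coxeter relations (s_i s_j)^(m_ij) = 1.
-- Its classes are exactly the elements of W = ⟨ S ∣ (s_i s_j)^(m_ij) = 1 ⟩.
data _≈[_]_ {k : ℕ} : Word k → CoxeterMatrix k → Word k → Set where
  ≈-refl  : ∀ {M x} → x ≈[ M ] x
  ≈-sym   : ∀ {M x y} → x ≈[ M ] y → y ≈[ M ] x
  ≈-trans : ∀ {M x y z} → x ≈[ M ] y → y ≈[ M ] z → x ≈[ M ] z
  ≈-rel   : ∀ {M} xs ys i j →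
            (xs ++ rel-word (m M i j) i j ++ ys) ≈[ M ] (xs ++ ys)

FiniteW : ∀ {k} → CoxeterMatrix k → Set
FiniteW {k} M = Σ (List (Word k)) λ ws →
  ∀ (w : Word k) → Σ (Word k) λ v → (v ∈ₗ ws) × (w ≈[ M ] v)

-- t ∈ T : t = u s u⁻¹ (the inverse of a word is its reversal, as generators are involutions)
IsReflection : ∀ {k} → CoxeterMatrix k → Word k → Set
IsReflection {k} M t = Σ (Word k) λ u → Σ (Fin k) λ s → t ≈[ M ] (u ++ [ s ] ++ reverse u)

SameCoset : ∀ {k} → CoxeterMatrix k → Subset k → Word k → Word k → Set
SameCoset {k} M I w v = Σ (Word k) λ u → All (_∈ I) u × (v ≈[ M ] (w ++ u))

CosetLength : ∀ {k} → CoxeterMatrix k → Subset k → Word k → ℕ → Set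
CosetLength {k} M I w n =
  (Σ (Word k) λ v → SameCoset M I w v × length v ≡ n) ×
  (∀ (v : Word k) → SameCoset M I w v → n ≤ length v)

InR : ∀ {k} → CoxeterMatrix k → Subset k → Word k → Word k → Set
InR M I t w = Σ ℕ λ a → Σ ℕ λ b →
  CosetLength M I (t ++ w) a × CosetLength M I w b × a < b

InL : ∀ {k} → CoxeterMatrix k → Subset k → Word k → Word k → Set
InL M I t w = Σ ℕ λ a → Σ ℕ λ b →
  CosetLength M I (t ++ w) a × CosetLength M I w b × b < a

-- subsets of W/W_I, represented by predicates on words (required coset-invariant below)
CosetPred : ℕ → Set₁
CosetPred k = Word k → Set

CosetInvariant : ∀ {k} → CoxeterMatrix k → Subset k → CosetPred k → Set
CosetInvariant M I J = ∀ w v → SameCoset M I w v → J w → J v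

J⁺ : ∀ {k} → CoxeterMatrix k → Subset k → Word k → CosetPred k → CosetPred k
J⁺ M I t J w = (InR M I t w × J (t ++ w)) ⊎ (¬ InR M I t w × J w)

J⁻ : ∀ {k} → CoxeterMatrix k → Subset k → Word k → CosetPred k → CosetPred k
J⁻ M I t J w = (InL M I t w × J (t ++ w)) ⊎ (¬ InL M I t w × J w)

_≐_ : ∀ {k} → CosetPred k → CosetPred k → Set
J ≐ J′ = ∀ w → (J w → J′ w) × (J′ w → J w)

FoldingStep : ∀ {k} → CoxeterMatrix k → Subset k → CosetPred k → CosetPred k → Set
FoldingStep {k} M I J J′ = Σ (Word k) λ t → IsReflection M t ×
  ((J′ ≐ J⁺ M I t J) ⊎ (J′ ≐ J⁻ M I t J))

PercolatingFromIdentity : ∀ {k} → CoxeterMatrix k → Subset k → Set₁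
PercolatingFromIdentity {k} M I = Σ ℕ λ N → Σ (ℕ → CosetPred k) λ J →
  (∀ i → CosetInvariant M I (J i)) ×
  (J 0 ≐ SameCoset M I []) ×
  (∀ w → J N w) ×
  (∀ i → i < N → FoldingStep M I (J i) (J (suc i)))

{-# OPTIONS --safe #-}
module Submission where

-- For s ∈ S the fold s⁺ moves wW_I to swW_I exactly
-- when s is a left descent of the coset, ℓ((sw)^I) < ℓ(w^I); so with J_(i+1) = J_i⁺(s_i),
-- J_i is the set of cosets that s_0⁺ ∘ ⋯ ∘ s_(i-1)⁺ carries to W_I.  Folds never increase
-- ℓ(w^I), and a coset without left descents is W_I itself (a shortest representative s v
-- has s as a descent).  Hence a round folding every generator once lowers ℓ(w^I) unless it
-- is already 0, and after max ℓ(w^I) rounds of the schedule s_i = i mod |S| every coset has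
-- reached W_I.  Constructively, ℓ(w^I) exists only once SameCoset is decidable; since W is
-- finite, the coset relation on a finite list of representatives of W is computed as the
-- least relation closed under the equivalence rules, left multiplication, the Coxeter
-- relations and aW_I = W_I for a ∈ I.

open import Defs
open import Data.Nat using (ℕ; zero; suc; z≤n; s≤s; _+_; _*_; _∸_; _≤_; _<_; _<?_; NonZero)
open import Data.Nat.Properties
  using ( ≤-refl; ≤-trans; ≤-<-trans; <⇒≤; ≮⇒≥; <⇒≱; ≤-antisym; <⇒≤pred; m<1+n⇒m<n∨m≡n
        ; n≤0⇒n≡0; suc-injective; m≤n+m; +-suc; +-identityʳ; +-comm; +-monoˡ-≤
        ; ∸-monoˡ-≤; ∸-+-assoc; pred[m∸n]≡m∸[1+n]; m≤n⇒m∸n≡0; anyUpTo?; module ≤-Reasoning )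
open import Data.Nat.DivMod using (_%_; _mod_; %-remove-+ˡ; m<n⇒m%n≡m)
open import Data.Nat.Divisibility using (n∣m*n)
open import Data.Nat.Induction using (<-wellFounded)
open import Data.Fin using (Fin; toℕ; combine; remQuot)
open import Data.Fin.Properties
  using (_≟_; any?; toℕ-fromℕ<; toℕ-injective; toℕ<n; remQuot-combine; combine-remQuot)
open import Data.Fin.Subset using (Subset; _∈_; _⊆_; _⊂_; ⊥; ∣_∣)
open import Data.Fin.Subset.Properties using (_∈?_; _⊂?_; ∉⊥; ∣p∣≤n; p⊂q⇒∣p∣<∣q∣)
open import Data.Bool using (Bool; T)
open import Data.Bool.Properties using (T-≡)
open import Data.Vec using (tabulate)
open import Data.Vec.Properties using (lookup∘tabulate; []=⇒lookup; lookup⇒[]=)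
open import Data.List using (List; []; _∷_; _++_; length; reverse; [_]; lookup; foldr)
open import Data.List.Properties using (++-assoc; ++-identityʳ; unfold-reverse; foldr-++)
open import Data.List.Relation.Unary.All as All using (All; []; _∷_)
import Data.List.Relation.Unary.All.Properties as Allₚ
import Data.List.Relation.Unary.Any as Any
open import Data.List.Relation.Unary.Any.Properties using (lookup-index; reverse⁻)
open import Data.List.Membership.Propositional using () renaming (_∈_ to _∈ₗ_)
open import Data.List.Extrema.Nat using (argmax; f[xs]≤f[argmax])
open import Data.Product using (∃; ∃₂; _×_; _,_; proj₁; proj₂; uncurry)
open import Data.Empty using (⊥-elim)
open import Data.Sum as Sum using (_⊎_; inj₁; inj₂)
open import Function using (id; _∘_; _⇔_; mk⇔; Equivalence)
open import Induction.WellFounded using (Acc; acc)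
open import Relation.Binary.Bundles using (Setoid)
open import Relation.Binary.PropositionalEquality
  using (_≡_; refl; sym; trans; cong; subst; subst₂; module ≡-Reasoning)
open import Relation.Nullary using (¬_; Dec; yes; no; contradiction)
open import Relation.Nullary.Decidable
  using (True; isYes; toWitness; fromWitness; map′; _×-dec_; _⊎-dec_)
open import Relation.Unary using (Decidable)

least-witness : {P : ℕ → Set} → Decidable P → ∀ {b} → P b →
                ∃ λ x → P x × (∀ {y} → P y → x ≤ y)
least-witness {P} P? Pb = descend Pb (<-wellFounded _)
  where
  descend : ∀ {b} → P b → Acc _<_ b → ∃ λ x → P x × (∀ {y} → P y → x ≤ y)
  descend {b} Pb (acc smaller) with anyUpTo? P? b
  ... | yes (x , x<b , Px) = descend Px (smaller x<b)
  ... | no ∄ = b , Pb , λ {y} Py → ≮⇒≥ λ y<b → ∄ (y , y<b , Py)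

any-of-length? : ∀ {k} {P : Word k → Set} → Decidable P →
                 ∀ l → Dec (∃ λ v → P v × length v ≡ l)
any-of-length? P? zero = map′ (λ p → [] , p , refl) (λ { ([] , p , _) → p }) (P? [])
any-of-length? P? (suc l) =
  map′ (λ (s , v , p , eq) → s ∷ v , p , cong suc eq)
       (λ { (s ∷ v , p , eq) → s , v , p , suc-injective eq })
       (any? λ s → any-of-length? (P? ∘ (s ∷_)) l)

∈-tabulate : ∀ {q} (f : Fin q → Bool) x → x ∈ tabulate f ⇔ T (f x)
∈-tabulate f x = mk⇔
  (λ x∈ → Equivalence.from T-≡ (trans (sym (lookup∘tabulate f x)) ([]=⇒lookup x∈)))
  (λ fx → lookup⇒[]= x (tabulate f) (trans (lookup∘tabulate f x) (Equivalence.to T-≡ fx)))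

⊆∧⊄⇒⊇ : ∀ {q} {P Q : Subset q} → P ⊆ Q → ¬ P ⊂ Q → Q ⊆ P
⊆∧⊄⇒⊇ {P = P} P⊆Q P⊄Q {x} x∈Q with x ∈? P
... | yes x∈P = x∈P
... | no x∉P = ⊥-elim (P⊄Q (P⊆Q , x , x∈Q , x∉P))

postfixpoint : ∀ {q} (F : Subset q → Subset q) → (∀ P → P ⊆ F P) →
               (Inv : Subset q → Set) → (∀ {P} → Inv P → Inv (F P)) → Inv ⊥ →
               ∃ λ P → Inv P × F P ⊆ P
postfixpoint {q} F F-inflationary Inv F-pres inv⊥ = iterate q ⊥ (m≤n+m q ∣ ⊥ {q} ∣) inv⊥
  where
  iterate : ∀ r P → q ≤ ∣ P ∣ + r → Inv P → ∃ λ P → Inv P × F P ⊆ P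
  iterate r P q≤ inv with P ⊂? F P
  ... | no P⊄FP = P , inv , ⊆∧⊄⇒⊇ (F-inflationary P) P⊄FP
  iterate zero P q≤ inv | yes P⊂FP =
    contradiction (subst (q ≤_) (+-identityʳ ∣ P ∣) q≤)
                  (<⇒≱ (≤-trans (p⊂q⇒∣p∣<∣q∣ P⊂FP) (∣p∣≤n (F P))))
  iterate (suc r) P q≤ inv | yes P⊂FP = iterate r (F P) (≤-trans q≤ grows) (F-pres inv)
    where
    grows : ∣ P ∣ + suc r ≤ ∣ F P ∣ + r
    grows = subst (_≤ ∣ F P ∣ + r) (sym (+-suc ∣ P ∣ r)) (+-monoˡ-≤ r (p⊂q⇒∣p∣<∣q∣ P⊂FP))

module CoxeterWords {k : ℕ} (M : CoxeterMatrix k) where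

  infix 4 _≈_
  _≈_ : Word k → Word k → Set
  x ≈ y = x ≈[ M ] y

  ≈-setoid : Setoid _ _
  ≈-setoid = record
    { Carrier = Word k ; _≈_ = _≈_
    ; isEquivalence = record { refl = ≈-refl ; sym = ≈-sym ; trans = ≈-trans } }

  ≈-prefix : ∀ zs {x y} → x ≈ y → zs ++ x ≈ zs ++ y
  ≈-prefix zs ≈-refl = ≈-refl
  ≈-prefix zs (≈-sym p) = ≈-sym (≈-prefix zs p)
  ≈-prefix zs (≈-trans p q) = ≈-trans (≈-prefix zs p) (≈-prefix zs q)
  ≈-prefix zs (≈-rel xs ys a b) =
    subst₂ _≈_ (++-assoc zs xs _) (++-assoc zs xs ys) (≈-rel (zs ++ xs) ys a b)

  ≈-suffix : ∀ zs {x y} → x ≈ y → x ++ zs ≈ y ++ zs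
  ≈-suffix zs ≈-refl = ≈-refl
  ≈-suffix zs (≈-sym p) = ≈-sym (≈-suffix zs p)
  ≈-suffix zs (≈-trans p q) = ≈-trans (≈-suffix zs p) (≈-suffix zs q)
  ≈-suffix zs (≈-rel xs ys a b) =
    subst₂ _≈_ (sym (trans (++-assoc xs (r ++ ys) zs) (cong (xs ++_) (++-assoc r ys zs))))
               (sym (++-assoc xs ys zs))
               (≈-rel xs (ys ++ zs) a b)
    where r = rel-word (m M a b) a b

  generator-involutive : ∀ s → s ∷ s ∷ [] ≈ []
  generator-involutive s = subst (λ c → rel-word c s s ++ [] ≈ []) (m-diag M s) (≈-rel [] [] s s)

  simple-reflection : ∀ s → IsReflection M [ s ]
  simple-reflection s = [] , s , ≈-refl

  ++-reverse-≈-[] : ∀ u → u ++ reverse u ≈ []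
  ++-reverse-≈-[] [] = ≈-refl
  ++-reverse-≈-[] (s ∷ u) = begin
    s ∷ u ++ reverse (s ∷ u)      ≡⟨ cong (λ r → s ∷ u ++ r) (unfold-reverse s u) ⟩
    s ∷ u ++ reverse u ++ [ s ]   ≡⟨ cong (s ∷_) (++-assoc u (reverse u) [ s ]) ⟨
    s ∷ (u ++ reverse u) ++ [ s ] ≈⟨ ≈-prefix [ s ] (≈-suffix [ s ] (++-reverse-≈-[] u)) ⟩
    s ∷ s ∷ []                    ≈⟨ generator-involutive s ⟩
    [] ∎
    where open import Relation.Binary.Reasoning.Setoid ≈-setoid

module Cosets {k : ℕ} (M : CoxeterMatrix k) (I : Subset k) where
  open CoxeterWords M

  infix 4 _∼_
  _∼_ : Word k → Word k → Set
  _∼_ = SameCoset M I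

  ∼-refl : ∀ w → w ∼ w
  ∼-refl w = [] , [] , subst (w ≈_) (sym (++-identityʳ w)) ≈-refl

  ∼-sym : ∀ {w v} → w ∼ v → v ∼ w
  ∼-sym {w} {v} (u , u∈I , v≈wu) =
    reverse u , All.tabulate (All.lookup u∈I ∘ reverse⁻) , ≈-sym (begin
      v ++ reverse u         ≈⟨ ≈-suffix (reverse u) v≈wu ⟩
      (w ++ u) ++ reverse u  ≡⟨ ++-assoc w u (reverse u) ⟩
      w ++ u ++ reverse u    ≈⟨ ≈-prefix w (++-reverse-≈-[] u) ⟩
      w ++ []                ≡⟨ ++-identityʳ w ⟩
      w ∎)
    where open import Relation.Binary.Reasoning.Setoid ≈-setoid

  ∼-trans : ∀ {w v x} → w ∼ v → v ∼ x → w ∼ x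
  ∼-trans {w} (u , u∈I , v≈wu) (u′ , u′∈I , x≈vu′) =
    u ++ u′ , Allₚ.++⁺ u∈I u′∈I ,
    ≈-trans x≈vu′ (subst (_ ≈_) (++-assoc w u u′) (≈-suffix u′ v≈wu))

  ≈⇒∼ : ∀ {w v} → w ≈ v → w ∼ v
  ≈⇒∼ {w} w≈v = [] , [] , subst (_ ≈_) (sym (++-identityʳ w)) (≈-sym w≈v)

  ∼-resp-≈ : ∀ {w w′ v v′} → w ≈ w′ → v ≈ v′ → w ∼ v → w′ ∼ v′
  ∼-resp-≈ w≈w′ v≈v′ w∼v = ∼-trans (≈⇒∼ (≈-sym w≈w′)) (∼-trans w∼v (≈⇒∼ v≈v′))

  ∷-resp-∼ : ∀ s {w v} → w ∼ v → s ∷ w ∼ s ∷ v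
  ∷-resp-∼ s (u , u∈I , v≈wu) = u , u∈I , ≈-prefix [ s ] v≈wu

  cosetLength-unique : ∀ {w a b} → CosetLength M I w a → CosetLength M I w b → a ≡ b
  cosetLength-unique ((v , w∼v , |v|≡a) , a-least) ((v′ , w∼v′ , |v′|≡b) , b-least) =
    ≤-antisym (subst (_ ≤_) |v′|≡b (a-least v′ w∼v′)) (subst (_ ≤_) |v|≡a (b-least v w∼v))

  single-coset-percolating : (∀ w → [] ∼ w) → PercolatingFromIdentity M I
  single-coset-percolating []∼ =
    0 , (λ _ → [] ∼_) , (λ _ _ _ w∼v []∼w → ∼-trans []∼w w∼v) , (λ _ → id , id) , []∼ , λ _ ()

module FiniteCosetDecision {k : ℕ} (M : CoxeterMatrix k) (I : Subset k) (ws : List (Word k))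
                           (represent : ∀ w → ∃ λ v → v ∈ₗ ws × w ≈[ M ] v) where
  open CoxeterWords M
  open Cosets M I

  n : ℕ
  n = length ws

  rep : Fin n → Word k
  rep = lookup ws

  index : Word k → Fin n
  index w = Any.index (proj₁ (proj₂ (represent w)))

  rep-index : ∀ w → rep (index w) ≈ w
  rep-index w = subst (_≈ w) (lookup-index v∈ws) (≈-sym w≈v)
    where v∈ws = proj₁ (proj₂ (represent w)) ; w≈v = proj₂ (proj₂ (represent w))

  infixr 5 _·_
  _·_ : Fin k → Fin n → Fin n
  s · i = index (s ∷ rep i)

  act : Word k → Fin n → Fin n
  act w i = foldr _·_ i w

  act-++ : ∀ xs ys i → act (xs ++ ys) i ≡ act xs (act ys i)
  act-++ xs ys i = foldr-++ _·_ i xs ys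

  e : Fin n
  e = index []

  rep-act : ∀ w i → rep (act w i) ≈ w ++ rep i
  rep-act [] i = ≈-refl
  rep-act (s ∷ w) i = ≈-trans (rep-index (s ∷ rep (act w i))) (≈-prefix [ s ] (rep-act w i))

  rep-act-e : ∀ w → rep (act w e) ≈ w
  rep-act-e w = begin
    rep (act w e) ≈⟨ rep-act w e ⟩
    w ++ rep e    ≈⟨ ≈-prefix w (rep-index []) ⟩
    w ++ []       ≡⟨ ++-identityʳ w ⟩
    w ∎
    where open import Relation.Binary.Reasoning.Setoid ≈-setoid

  -- Relations on the representatives are subsets of Fin (n * n) (pairs encoded by
  -- combine), so that the closure under Rule is a post-fixpoint of step.
  infix 4 _⊢_≋_
  _⊢_≋_ : Subset (n * n) → Fin n → Fin n → Set
  R ⊢ i ≋ j = combine i j ∈ R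

  Rule : Subset (n * n) → Fin n → Fin n → Set
  Rule R i j = R ⊢ i ≋ j
             ⊎ i ≡ j
             ⊎ R ⊢ j ≋ i
             ⊎ (∃ λ l → R ⊢ i ≋ l × R ⊢ l ≋ j)
             ⊎ (∃₂ λ s i′ → ∃ λ j′ → s · i′ ≡ i × s · j′ ≡ j × R ⊢ i′ ≋ j′)
             ⊎ (∃₂ λ a b → act (rel-word (m M a b) a b) j ≡ i)
             ⊎ (i ≡ e × ∃ λ a → a ∈ I × a · e ≡ j)

  pattern by-member r = inj₁ r
  pattern by-refl = inj₂ (inj₁ refl)
  pattern by-sym r = inj₂ (inj₂ (inj₁ r))
  pattern by-trans r r′ = inj₂ (inj₂ (inj₂ (inj₁ (_ , r , r′))))
  pattern by-cong s r = inj₂ (inj₂ (inj₂ (inj₂ (inj₁ (s , _ , _ , refl , refl , r)))))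
  pattern by-relator a b = inj₂ (inj₂ (inj₂ (inj₂ (inj₂ (inj₁ (a , b , refl))))))
  pattern by-coset a a∈I = inj₂ (inj₂ (inj₂ (inj₂ (inj₂ (inj₂ (refl , a , a∈I , refl))))))

  rule? : ∀ R i j → Dec (Rule R i j)
  rule? R i j =
    (combine i j ∈? R) ⊎-dec (i ≟ j) ⊎-dec (combine j i ∈? R)
    ⊎-dec any? (λ l → (combine i l ∈? R) ×-dec (combine l j ∈? R))
    ⊎-dec any? (λ s → any? λ i′ → any? λ j′ →
                 (s · i′ ≟ i) ×-dec (s · j′ ≟ j) ×-dec (combine i′ j′ ∈? R))
    ⊎-dec any? (λ a → any? λ b → act (rel-word (m M a b) a b) j ≟ i)
    ⊎-dec ((i ≟ e) ×-dec any? (λ a → (a ∈? I) ×-dec (a · e ≟ j)))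

  rule-holds : Subset (n * n) → Fin (n * n) → Bool
  rule-holds R p = isYes (uncurry (rule? R) (remQuot {n} n p))

  step : Subset (n * n) → Subset (n * n)
  step R = tabulate (rule-holds R)

  step-≋ : ∀ {R i j} → step R ⊢ i ≋ j ⇔ Rule R i j
  step-≋ {R} {i} {j} = mk⇔
    (toWitness ∘ subst Holds (remQuot-combine i j) ∘ Equivalence.to ∈-step)
    (Equivalence.from ∈-step ∘ subst Holds (sym (remQuot-combine i j)) ∘ fromWitness)
    where
    ∈-step = ∈-tabulate (rule-holds R) (combine i j)
    Holds : Fin n × Fin n → Set
    Holds p = True (uncurry (rule? R) p)

  step-inflationary : ∀ R → R ⊆ step R
  step-inflationary R {p} p∈R =
    subst (_∈ step R) (combine-remQuot {n} n p)
          (Equivalence.from step-≋ (by-member (subst (_∈ R) (sym (combine-remQuot {n} n p)) p∈R)))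

  Sound : Subset (n * n) → Set
  Sound R = ∀ {i j} → R ⊢ i ≋ j → rep i ∼ rep j

  step-sound : ∀ {R} → Sound R → Sound (step R)
  step-sound {R} sound = rule-sound ∘ Equivalence.to step-≋
    where
    rule-sound : ∀ {i j} → Rule R i j → rep i ∼ rep j
    rule-sound (by-member r) = sound r
    rule-sound by-refl = ∼-refl _
    rule-sound (by-sym r) = ∼-sym (sound r)
    rule-sound (by-trans r r′) = ∼-trans (sound r) (sound r′)
    rule-sound (by-cong s r) =
      ∼-resp-≈ (≈-sym (rep-index _)) (≈-sym (rep-index _)) (∷-resp-∼ s (sound r))
    rule-sound {j = j} (by-relator a b) = ≈⇒∼ (≈-trans (rep-act _ j) (≈-rel [] (rep j) a b))
    rule-sound (by-coset a a∈I) =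
      ∼-resp-≈ (≈-sym (rep-index []))
               (≈-sym (≈-trans (rep-act [ a ] e) (≈-prefix [ a ] (rep-index []))))
               ([ a ] , a∈I ∷ [] , ≈-refl)

  closure : ∃ λ C → Sound C × step C ⊆ C
  closure = postfixpoint step step-inflationary Sound step-sound (⊥-elim ∘ ∉⊥)

  C : Subset (n * n)
  C = proj₁ closure

  infix 4 _≃_
  _≃_ : Fin n → Fin n → Set
  i ≃ j = C ⊢ i ≋ j

  ≃-sound : ∀ {i j} → i ≃ j → rep i ∼ rep j
  ≃-sound = proj₁ (proj₂ closure)

  ≃-closed : ∀ {i j} → Rule C i j → i ≃ j
  ≃-closed = proj₂ (proj₂ closure) ∘ Equivalence.from step-≋

  ≃-refl : ∀ {i} → i ≃ i
  ≃-refl = ≃-closed by-refl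

  ≃-sym : ∀ {i j} → i ≃ j → j ≃ i
  ≃-sym r = ≃-closed (by-sym r)

  ≃-trans : ∀ {i j l} → i ≃ j → j ≃ l → i ≃ l
  ≃-trans r r′ = ≃-closed (by-trans r r′)

  act-resp-≃ : ∀ w {i j} → i ≃ j → act w i ≃ act w j
  act-resp-≃ [] r = r
  act-resp-≃ (s ∷ w) r = ≃-closed (by-cong s (act-resp-≃ w r))

  ≈⇒≃ : ∀ {x y} → x ≈ y → ∀ i → act x i ≃ act y i
  ≈⇒≃ ≈-refl i = ≃-refl
  ≈⇒≃ (≈-sym p) i = ≃-sym (≈⇒≃ p i)
  ≈⇒≃ (≈-trans p q) i = ≃-trans (≈⇒≃ p i) (≈⇒≃ q i)
  ≈⇒≃ (≈-rel xs ys a b) i =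
    subst₂ _≃_ (sym (trans (act-++ xs _ i) (cong (act xs) (act-++ (rel-word (m M a b) a b) ys i))))
               (sym (act-++ xs ys i))
               (act-resp-≃ xs (≃-closed (by-relator a b)))

  act-I-≃ : ∀ {u} → All (_∈ I) u → act u e ≃ e
  act-I-≃ [] = ≃-refl
  act-I-≃ (a∈I ∷ u∈I) = ≃-trans (act-resp-≃ [ _ ] (act-I-≃ u∈I)) (≃-sym (≃-closed (by-coset _ a∈I)))

  ∼⇒≃ : ∀ {w v} → w ∼ v → act w e ≃ act v e
  ∼⇒≃ {w} {v} (u , u∈I , v≈wu) =
    ≃-sym (≃-trans (subst (act v e ≃_) (act-++ w u e) (≈⇒≃ v≈wu e)) (act-resp-≃ w (act-I-≃ u∈I)))

  ≃⇒∼ : ∀ {w v} → act w e ≃ act v e → w ∼ v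
  ≃⇒∼ {w} {v} r = ∼-resp-≈ (rep-act-e w) (rep-act-e v) (≃-sound r)

  _∼?_ : ∀ w v → Dec (w ∼ v)
  w ∼? v = map′ ≃⇒∼ ∼⇒≃ (combine (act w e) (act v e) ∈? C)

module CosetFolding {k : ℕ} (M : CoxeterMatrix k) (I : Subset k)
                    (_∼?_ : ∀ w v → Dec (SameCoset M I w v)) where
  open CoxeterWords M
  open Cosets M I

  cosetLength : ∀ w → ∃ (CosetLength M I w)
  cosetLength w with least-witness (any-of-length? (w ∼?_)) (w , ∼-refl w , refl)
  ... | c , shortest , c-least = c , shortest , λ v w∼v → c-least (v , w∼v , refl)

  ℓ : Word k → ℕ
  ℓ w = proj₁ (cosetLength w)

  ℓ-spec : ∀ w → CosetLength M I w (ℓ w)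
  ℓ-spec w = proj₂ (cosetLength w)

  ℓ-≤-length : ∀ {w v} → w ∼ v → ℓ w ≤ length v
  ℓ-≤-length {w} = proj₂ (ℓ-spec w) _

  shortest : ∀ w → ∃ λ v → w ∼ v × length v ≡ ℓ w
  shortest w = proj₁ (ℓ-spec w)

  ℓ-resp-∼ : ∀ {w v} → w ∼ v → ℓ w ≡ ℓ v
  ℓ-resp-∼ {w} {v} w∼v = ≤-antisym (ℓ-via v w∼v) (ℓ-via w (∼-sym w∼v))
    where
    ℓ-via : ∀ {x} y → x ∼ y → ℓ x ≤ ℓ y
    ℓ-via y x∼y with shortest y
    ... | v′ , y∼v′ , |v′|≡ℓy = subst (_ ≤_) |v′|≡ℓy (ℓ-≤-length (∼-trans x∼y y∼v′))

  ℓ≡0⇒[]∼ : ∀ {w} → ℓ w ≡ 0 → [] ∼ w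
  ℓ≡0⇒[]∼ {w} ℓw≡0 with shortest w
  ... | [] , w∼[] , _ = ∼-sym w∼[]
  ... | _ ∷ _ , _ , |v|≡ℓw with () ← trans |v|≡ℓw ℓw≡0

  ℓ-bounded : ((ws , _) : FiniteW M) → ∀ w → ℓ w ≤ length (argmax length [] ws)
  ℓ-bounded (ws , represent) w with represent w
  ... | v , v∈ws , w≈v = ≤-trans (ℓ-≤-length (≈⇒∼ w≈v)) (All.lookup (f[xs]≤f[argmax] [] ws) v∈ws)

  Descent : Fin k → Word k → Set
  Descent s w = ℓ (s ∷ w) < ℓ w

  -- Opaque, so that `with descent? s w` also abstracts the test inside `fold s w`.
  opaque
    descent? : ∀ s w → Dec (Descent s w)
    descent? s w = ℓ (s ∷ w) <? ℓ w

  InR⇔Descent : ∀ {s w} → InR M I [ s ] w ⇔ Descent s w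
  InR⇔Descent {s} {w} = mk⇔
    (λ (a , b , a-spec , b-spec , a<b) →
      subst₂ _<_ (cosetLength-unique a-spec (ℓ-spec (s ∷ w)))
                 (cosetLength-unique b-spec (ℓ-spec w)) a<b)
    (λ d → ℓ (s ∷ w) , ℓ w , ℓ-spec (s ∷ w) , ℓ-spec w , d)

  descent-resp-∼ : ∀ {s w v} → w ∼ v → Descent s w → Descent s v
  descent-resp-∼ {s} w∼v = subst₂ _<_ (ℓ-resp-∼ (∷-resp-∼ s w∼v)) (ℓ-resp-∼ w∼v)

  no-descent⇒ℓ≡0 : ∀ {w} → (∀ s → ¬ Descent s w) → ℓ w ≡ 0
  no-descent⇒ℓ≡0 {w} none with shortest w
  ... | [] , _ , |[]|≡ℓw = sym |[]|≡ℓw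
  ... | s ∷ v , w∼sv , |sv|≡ℓw =
    contradiction (subst (ℓ (s ∷ w) <_) |sv|≡ℓw (s≤s (ℓ-≤-length s∷w∼v))) (none s)
    where
    s∷w∼v : s ∷ w ∼ v
    s∷w∼v = ∼-resp-≈ ≈-refl (≈-suffix v (generator-involutive s)) (∷-resp-∼ s w∼sv)

  fold : Fin k → Word k → Word k
  fold s w with descent? s w
  ... | yes _ = s ∷ w
  ... | no _ = w

  fold-descent : ∀ {s w} → Descent s w → fold s w ≡ s ∷ w
  fold-descent {s} {w} d with descent? s w
  ... | yes _ = refl
  ... | no ¬d = contradiction d ¬d

  fold-no-descent : ∀ {s w} → ¬ Descent s w → fold s w ≡ w
  fold-no-descent {s} {w} ¬d with descent? s w
  ... | yes d = contradiction d ¬d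
  ... | no _ = refl

  fold-resp-∼ : ∀ s {w v} → w ∼ v → fold s w ∼ fold s v
  fold-resp-∼ s {w} {v} w∼v with descent? s w
  ... | yes d = subst (s ∷ w ∼_) (sym (fold-descent (descent-resp-∼ w∼v d))) (∷-resp-∼ s w∼v)
  ... | no ¬d = subst (w ∼_) (sym (fold-no-descent (¬d ∘ descent-resp-∼ (∼-sym w∼v)))) w∼v

  ℓ-fold-≤ : ∀ s w → ℓ (fold s w) ≤ ℓ w
  ℓ-fold-≤ s w with descent? s w
  ... | yes d = <⇒≤ d
  ... | no _ = ≤-refl

  fold-preimage-J⁺ : ∀ s (J : CosetPred k) w → J (fold s w) ⇔ J⁺ M I [ s ] J w
  fold-preimage-J⁺ s J w with descent? s w
  ... | yes d = mk⇔ (λ J-sw → inj₁ (Equivalence.from InR⇔Descent d , J-sw))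
    λ { (inj₁ (_ , J-sw)) → J-sw
      ; (inj₂ (¬r , _)) → contradiction (Equivalence.from InR⇔Descent d) ¬r }
  ... | no ¬d = mk⇔ (λ J-w → inj₂ (¬d ∘ Equivalence.to InR⇔Descent , J-w))
    λ { (inj₁ (r , _)) → contradiction (Equivalence.to InR⇔Descent r) ¬d
      ; (inj₂ (_ , J-w)) → J-w }

  folds : (ℕ → Fin k) → ℕ → Word k → Word k
  folds τ zero w = w
  folds τ (suc i) w = folds τ i (fold (τ i) w)

  folds-resp-∼ : ∀ τ i {w v} → w ∼ v → folds τ i w ∼ folds τ i v
  folds-resp-∼ τ zero w∼v = w∼v
  folds-resp-∼ τ (suc i) w∼v = folds-resp-∼ τ i (fold-resp-∼ (τ i) w∼v)

  ℓ-folds-≤ : ∀ τ i w → ℓ (folds τ i w) ≤ ℓ w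
  ℓ-folds-≤ τ zero w = ≤-refl
  ℓ-folds-≤ τ (suc i) w = ≤-trans (ℓ-folds-≤ τ i (fold (τ i) w)) (ℓ-fold-≤ (τ i) w)

  folds-+ : ∀ τ i j w → folds τ (i + j) w ≡ folds τ i (folds (λ x → τ (i + x)) j w)
  folds-+ τ i zero w = cong (λ x → folds τ x w) (+-identityʳ i)
  folds-+ τ i (suc j) w =
    trans (cong (λ x → folds τ x w) (+-suc i j)) (folds-+ τ i j (fold (τ (i + j)) w))

  ℓ-folds-<-or-no-descent : ∀ τ j w →
                            ℓ (folds τ j w) < ℓ w ⊎ (∀ {i} → i < j → ¬ Descent (τ i) w)
  ℓ-folds-<-or-no-descent τ zero w = inj₂ λ ()
  ℓ-folds-<-or-no-descent τ (suc j) w with descent? (τ j) w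
  ... | yes d = inj₁ (≤-<-trans (ℓ-folds-≤ τ j (τ j ∷ w)) d)
  ... | no ¬d = Sum.map₂ extend (ℓ-folds-<-or-no-descent τ j w)
    where
    extend : (∀ {i} → i < j → ¬ Descent (τ i) w) → ∀ {i} → i < suc j → ¬ Descent (τ i) w
    extend none i<1+j with m<1+n⇒m<n∨m≡n i<1+j
    ... | inj₁ i<j = none i<j
    ... | inj₂ refl = ¬d

  ℓ-round-≤ : ∀ τ → (∀ s → ∃ λ i → i < k × τ i ≡ s) → ∀ w → ℓ (folds τ k w) ≤ ℓ w ∸ 1
  ℓ-round-≤ τ visits w with ℓ-folds-<-or-no-descent τ k w
  ... | inj₁ ℓ-drops = subst (ℓ (folds τ k w) ≤_) (pred[m∸n]≡m∸[1+n] (ℓ w) 0) (<⇒≤pred ℓ-drops)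
  ... | inj₂ none = ≤-trans (ℓ-folds-≤ τ k w) (subst (λ c → c ≤ c ∸ 1) (sym ℓw≡0) z≤n)
    where
    ℓw≡0 : ℓ w ≡ 0
    ℓw≡0 = no-descent⇒ℓ≡0 {w} λ s →
      let (i , i<k , τi≡s) = visits s in subst (λ t → ¬ Descent t w) τi≡s (none i<k)

  EveryRoundVisitsAll : (ℕ → Fin k) → Set
  EveryRoundVisitsAll τ = ∀ a s → ∃ λ i → i < k × τ (a * k + i) ≡ s

  ℓ-rounds-≤ : ∀ τ → EveryRoundVisitsAll τ → ∀ a w → ℓ (folds τ (a * k) w) ≤ ℓ w ∸ a
  ℓ-rounds-≤ τ visits zero w = ≤-refl
  ℓ-rounds-≤ τ visits (suc a) w = begin
    ℓ (folds τ (k + a * k) w)          ≡⟨ cong (λ x → ℓ (folds τ x w)) (+-comm k (a * k)) ⟩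
    ℓ (folds τ (a * k + k) w)          ≡⟨ cong ℓ (folds-+ τ (a * k) k w) ⟩
    ℓ (folds τ (a * k) (folds τ′ k w)) ≤⟨ ℓ-rounds-≤ τ visits a _ ⟩
    ℓ (folds τ′ k w) ∸ a               ≤⟨ ∸-monoˡ-≤ a (ℓ-round-≤ τ′ (visits a) w) ⟩
    ℓ w ∸ 1 ∸ a                        ≡⟨ ∸-+-assoc (ℓ w) 1 a ⟩
    ℓ w ∸ suc a                        ∎
    where
    open ≤-Reasoning
    τ′ : ℕ → Fin k
    τ′ x = τ (a * k + x)

  percolating : ∀ {L} → (∀ w → ℓ w ≤ L) →
                (τ : ℕ → Fin k) → EveryRoundVisitsAll τ → PercolatingFromIdentity M I
  percolating {L} ℓ≤L τ visits =
    L * k , J , J-invariant , (λ _ → id , id) , J-total , λ i _ → J-step i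
    where
    J : ℕ → CosetPred k
    J i w = [] ∼ folds τ i w

    J-invariant : ∀ i → CosetInvariant M I (J i)
    J-invariant i _ _ w∼v []∼w = ∼-trans []∼w (folds-resp-∼ τ i w∼v)

    J-total : ∀ w → J (L * k) w
    J-total w = ℓ≡0⇒[]∼ (n≤0⇒n≡0 (begin
      ℓ (folds τ (L * k) w) ≤⟨ ℓ-rounds-≤ τ visits L w ⟩
      ℓ w ∸ L               ≡⟨ m≤n⇒m∸n≡0 (ℓ≤L w) ⟩
      0                     ∎))
      where open ≤-Reasoning

    J-step : ∀ i → FoldingStep M I (J i) (J (suc i))
    J-step i = [ τ i ] , simple-reflection (τ i) , inj₁ λ w →
      let open Equivalence (fold-preimage-J⁺ (τ i) (J i) w) in to , from

mod-visits : ∀ k .{{_ : NonZero k}} a (s : Fin k) → (a * k + toℕ s) mod k ≡ s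
mod-visits k a s = toℕ-injective (begin
  toℕ ((a * k + toℕ s) mod k) ≡⟨ toℕ-fromℕ< _ ⟩
  (a * k + toℕ s) % k         ≡⟨ %-remove-+ˡ (toℕ s) (n∣m*n a) ⟩
  toℕ s % k                   ≡⟨ m<n⇒m%n≡m (toℕ<n s) ⟩
  toℕ s                       ∎)
  where open ≡-Reasoning

theorem3p3 : (k : ℕ) (M : CoxeterMatrix k) → FiniteW M → (I : Subset k) →
    PercolatingFromIdentity M I
theorem3p3 zero M _ I = single-coset-percolating λ { [] → ∼-refl [] }
  where open Cosets M I using (single-coset-percolating; ∼-refl)
theorem3p3 k@(suc _) M finite@(ws , represent) I =
  percolating (ℓ-bounded finite) (_mod k) (λ a s → toℕ s , toℕ<n s , mod-visits k a s)
  where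
  open FiniteCosetDecision M I ws represent using (_∼?_)
  open CosetFolding M I _∼?_ using (ℓ-bounded; percolating)
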